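{- Let $k\ge 2$ and let $\mathbf{P}=(X,D,P,\mathbf{A})$ be a soft CSP over a divisible residuated lattice satisfying the standing assumptions below, with $X=\{1,\dots,n\}$, $d=\max_{i\in X}|D_i|$ and $e=|P|$. Then the algorithm $k$-HyperarcConsistency (described below) on input $\mathbf{P}$ terminates in at most $O(e^2\cdot d^{k+1})$ time.
   Context: A divisible residuated lattice (DRL) is an algebra $(A,\vee,\wedge,\odot,\rightarrow,\top,\bot)$ such that $(A,\odot,\top)$ is a commutative monoid, $(A,\vee,\wedge,\top,\bot)$ is a bounded lattice (with $x\le y$ iff $x\wedge y=x$), residuation holds ($x\odot z\le y$ iff $z\le x\rightarrow y$), and divisibility holds ($x\wedge y=x\odot(x\rightarrow y)$). A soft CSP is a tuple $\mathbf{P}=(X,D,P,\mathbf{A})$ with variables $X=\{1,\dots,n\}$, finite domains $D=\{D_i\}$, valuation structure $\mathbf{A}$ (here a DRL), and a finite multiset $P$ of constraints $C_Y:l(Y)\to A$, $Y\subseteq X$, $l(Y)=\prod_{i\in Y}D_i$. For $i\in Y$, $a\in D_i$, $t\in l(Y\setminus\{i\})$, $t\cdot a\in l(Y)$ is the tuple extending $t$ by value $a$ at $i$. Standing assumptions: at most one constraint per nonempty scope; a unary constraint $C_{\{i\}}$ exists for each $i$; $C_{\{i\}}(a)>\bot$ for all $a\in D_i$; constraints are tables whose entries can be read and modified (each algebraic operation of $\mathbf{A}$, comparison, and table access counted as an elementary step). Algorithm $k$-HyperarcConsistency: initialize a queue $Q:=\{1,\dots,n\}$. While $Q\neq\emptyset$: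 pop some $i$; for each $Y\subseteq X$ with $2\le|Y|\le k$, $i\in Y$, $C_Y\in P$, call Project$(Y,i)$: set flag $:=$ false; for each $a\in D_i$ with $C_{\{i\}}(a)>\bot$: let $x$ be a maximal element of $\{C_Y(t\cdot a):t\in l(Y\setminus\{i\})\}$; set $C_{\{i\}}(a):=C_{\{i\}}(a)\odot x$; if now $C_{\{i\}}(a)=\bot$ set flag $:=$ true; for each $t\in l(Y\setminus\{i\})$ set $C_Y(t\cdot a):=x\rightarrow C_Y(t\cdot a)$; return flag. After each call: if $C_{\{i\}}(a)=\bot$ for all $a\in D_i$, halt with output $\bot$; else if flag is true, push $i$ onto $Q$. When $Q$ is empty, output the current CSP. -}

module Defs where

open import Level using (Level) renaming (suc to lsuc)
open import Function using (_∘_)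
open import Data.Bool using (Bool; true; false)
open import Data.Unit using () renaming (⊤ to Unit; tt to unit)
open import Data.Product using (Σ; ∃; _×_; _,_)
open import Data.Sum using (_⊎_)
open import Data.Nat using (ℕ; zero; suc; _≤_; _+_; _*_; _^_; _⊔_; _≤?_)
open import Data.Fin using (Fin; zero; suc)
import Data.Fin.Properties as FinP
open import Data.Fin.Subset using (Subset; _∈_; ∣_∣; _-_; Nonempty)
open import Data.Fin.Subset.Properties using (_∈?_)
open import Data.Vec using ([]; _∷_; here; there)
open import Data.List using (List; []; _∷_; _++_; filter; foldr; map)
open import Data.List.Base using (allFin)
open import Relation.Nullary using (¬_; yes; no)
open import Relation.Nullary.Decidable using (_×-dec_)
open import Relation.Binary.PropositionalEquality using (_≡_; _≢_; refl)
open import Relation.Binary.Definitions using (DecidableEquality)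
open import Algebra.Structures using (IsCommutativeMonoid)
open import Algebra.Lattice.Structures using (IsLattice)

record DRL (ℓ : Level) : Set (lsuc ℓ) where
  infixr 6 _∨_
  infixr 7 _∧_
  infixr 7 _⊙_
  infixr 5 _⇒_
  field
    Carrier : Set ℓ
    _∨_ _∧_ _⊙_ _⇒_ : Carrier → Carrier → Carrier
    ⊤ₐ ⊥ₐ : Carrier
    ⊙-isCommutativeMonoid : IsCommutativeMonoid _≡_ _⊙_ ⊤ₐ
    isLattice : IsLattice _≡_ _∨_ _∧_
    ⊥-least : ∀ x → ⊥ₐ ∧ x ≡ ⊥ₐ
    ⊤-greatest : ∀ x → x ∧ ⊤ₐ ≡ x
    -- residuation: x ⊙ z ≤ y  iff  z ≤ x ⇒ y   (with u ≤ v iff u ∧ v ≡ u)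
    residuation-to : ∀ x y z → (x ⊙ z) ∧ y ≡ x ⊙ z → z ∧ (x ⇒ y) ≡ z
    residuation-from : ∀ x y z → z ∧ (x ⇒ y) ≡ z → (x ⊙ z) ∧ y ≡ x ⊙ z
    divisibility : ∀ x y → x ∧ y ≡ x ⊙ (x ⇒ y)
    -- elements can be compared (the algorithm tests equalities / comparisons)
    _≟_ : DecidableEquality Carrier

  _≤ₐ_ : Carrier → Carrier → Set ℓ
  x ≤ₐ y = x ∧ y ≡ x

  _<ₐ_ : Carrier → Carrier → Set ℓ
  x <ₐ y = x ≤ₐ y × x ≢ y

Tuple : ∀ {n} → (Fin n → ℕ) → Subset n → Set
Tuple {zero} D [] = Unit
Tuple {suc n} D (true ∷ Y) = Fin (D zero) × Tuple (D ∘ suc) Y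
Tuple {suc n} D (false ∷ Y) = Tuple (D ∘ suc) Y

get : ∀ {n} (D : Fin n → ℕ) (Y : Subset n) → Tuple D Y → (v : Fin n) → v ∈ Y → Fin (D v)
get D (true ∷ Y) (a , t) zero here = a
get D (true ∷ Y) (a , t) (suc v) (there p) = get (D ∘ suc) Y t v p
get D (false ∷ Y) t (suc v) (there p) = get (D ∘ suc) Y t v p

card : ∀ {n} → (Fin n → ℕ) → Subset n → ℕ
card {zero} D [] = 1
card {suc n} D (true ∷ Y) = D zero * card (D ∘ suc) Y
card {suc n} D (false ∷ Y) = card (D ∘ suc) Y

-- The unary constraints C_{i} (one per variable) are stored separately
-- in `unary₀`; all other constraints (scopes of size ≠ 1) are indexed by Fin m.
-- Hence |P| = n + m.

record SoftCSP {ℓ} (A : DRL ℓ) (n : ℕ) : Set ℓ where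
  open DRL A
  field
    D : Fin n → ℕ
    D-nonempty : ∀ i → 1 ≤ D i
    m : ℕ
    scope : Fin m → Subset n
    scope-not-unary : ∀ j → ∣ scope j ∣ ≢ 1
    scope-distinct : ∀ j j' → Nonempty (scope j) → scope j ≡ scope j' → j ≡ j'
    unary₀ : (i : Fin n) → Fin (D i) → Carrier
    unary₀-pos : ∀ i a → ⊥ₐ <ₐ unary₀ i a
    table₀ : (j : Fin m) → Tuple D (scope j) → Carrier

  e : ℕ
  e = n + m

  d : ℕ
  d = foldr _⊔_ 0 (map D (allFin n))

-- The algorithm k-HyperarcConsistency as a nondeterministic transition
-- system with costs (number of elementary steps, up to a constant factor).

module Algorithm {ℓ} (A : DRL ℓ) {n : ℕ} (P : SoftCSP A n) (k : ℕ) where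
  open DRL A
  open SoftCSP P

  data Phase : Set where
    idle       : Phase
    processing : Fin n → List (Fin m) → Phase   -- current variable, constraints still to project
    haltedBot  : Phase

  record State : Set ℓ where
    field
      unary : (i : Fin n) → Fin (D i) → Carrier
      table : (j : Fin m) → Tuple D (scope j) → Carrier
      queue : List (Fin n)
      phase : Phase
  open State public

  initial : State
  initial = record { unary = unary₀ ; table = table₀ ; queue = allFin n ; phase = idle }

  relevant : Fin n → List (Fin m)
  relevant i = filter (λ j → (i ∈? scope j) ×-dec ((2 ≤? ∣ scope j ∣) ×-dec (∣ scope j ∣ ≤? k))) (allFin m)

  updUnary : (i : Fin n) → (Fin (D i) → Carrier) →
             ((v : Fin n) → Fin (D v) → Carrier) → (v : Fin n) → Fin (D v) → Carrier
  updUnary i u f v with v FinP.≟ i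
  ... | yes refl = u
  ... | no _ = f v

  updTable : (j : Fin m) → (Tuple D (scope j) → Carrier) →
             ((j' : Fin m) → Tuple D (scope j') → Carrier) → (j' : Fin m) → Tuple D (scope j') → Carrier
  updTable j t f j' with j' FinP.≟ j
  ... | yes refl = t
  ... | no _ = f j'

  IsMaximal : (Carrier → Set ℓ) → Carrier → Set ℓ
  IsMaximal S x = S x × (∀ y → S y → x ≤ₐ y → y ≡ x)

  -- Project(Y,i) with Y = scope j : old state s, new unary table u' of i,
  -- new table t' of C_Y.
  record ProjectOutcome (s : State) (i : Fin n) (j : Fin m) (p : i ∈ scope j)
                        (u' : Fin (D i) → Carrier) (t' : Tuple D (scope j) → Carrier) : Set ℓ where
    Active : Fin (D i) → Set ℓ
    Active a = ⊥ₐ <ₐ unary s i a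
    field
      x : Fin (D i) → Carrier
      x-max : ∀ a → Active a →
              IsMaximal (λ v → Σ (Tuple D (scope j)) λ t → get D (scope j) t i p ≡ a × table s j t ≡ v) (x a)
      unary-active : ∀ a → Active a → u' a ≡ unary s i a ⊙ x a
      unary-inactive : ∀ a → ¬ Active a → u' a ≡ unary s i a
      table-active : ∀ t → Active (get D (scope j) t i p) → t' t ≡ x (get D (scope j) t i p) ⇒ table s j t
      table-inactive : ∀ t → ¬ Active (get D (scope j) t i p) → t' t ≡ table s j t

  Flag : State → (i : Fin n) → (Fin (D i) → Carrier) → Set ℓ
  Flag s i u' = ∃ λ a → ⊥ₐ <ₐ unary s i a × u' a ≡ ⊥ₐ

  -- cost of a pop: popping plus scanning the e constraints of P
  popCost : ℕ
  popCost = 1 + e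

  -- cost of Project(Y,i): for each a ∈ D_i, O(1 + |l(Y∖{i})|) steps
  projCost : Fin n → Fin m → ℕ
  projCost i j = D i * (1 + card D (scope j - i))

  data Step : State → ℕ → State → Set ℓ where
    pop : ∀ {s} xs i ys → phase s ≡ idle → queue s ≡ xs ++ i ∷ ys →
          Step s popCost (record s { queue = xs ++ ys ; phase = processing i (relevant i) })
    finish : ∀ {s} i → phase s ≡ processing i [] →
          Step s 1 (record s { phase = idle })
    project-halt : ∀ {s} i rs j rs' (p : i ∈ scope j) u' t' →
          phase s ≡ processing i (rs ++ j ∷ rs') → ProjectOutcome s i j p u' t' →
          (∀ a → u' a ≡ ⊥ₐ) →
          Step s (projCost i j)
            (record s { unary = updUnary i u' (unary s) ; table = updTable j t' (table s) ; phase = haltedBot })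
    project-push : ∀ {s} i rs j rs' (p : i ∈ scope j) u' t' →
          phase s ≡ processing i (rs ++ j ∷ rs') → ProjectOutcome s i j p u' t' →
          ¬ (∀ a → u' a ≡ ⊥ₐ) → Flag s i u' →
          Step s (projCost i j)
            (record s { unary = updUnary i u' (unary s) ; table = updTable j t' (table s)
                      ; queue = i ∷ queue s ; phase = processing i (rs ++ rs') })
    project-continue : ∀ {s} i rs j rs' (p : i ∈ scope j) u' t' →
          phase s ≡ processing i (rs ++ j ∷ rs') → ProjectOutcome s i j p u' t' →
          ¬ (∀ a → u' a ≡ ⊥ₐ) → ¬ Flag s i u' →
          Step s (projCost i j)
            (record s { unary = updUnary i u' (unary s) ; table = updTable j t' (table s)
                      ; phase = processing i (rs ++ rs') })

  data Reach : State → ℕ → Set ℓ where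
    start : Reach initial 0
    step  : ∀ {s c s' w} → Reach s c → Step s w s' → Reach s' (c + w)

  Terminal : State → Set
  Terminal s = phase s ≡ haltedBot ⊎ (phase s ≡ idle × queue s ≡ [])

-- Amortised analysis.  A call Project(Y, i) with |Y| ≤ k costs |D_i| (1 + |l(Y ∖ {i})|) ≤ d + d^k,
-- and a pop schedules at most m of them, so R = (1 + e) + 1 + m (d + d^k) pays for a pop together
-- with everything it triggers.  With the potential
--   Φ = (|Q| + #{(i , a) : C_{i}(a) > ⊥}) · R + [1 + (d + d^k) · #(projections still to run)],
-- every step costs at most the drop of Φ: a pop removes a queue entry, and a projection never
-- revives an entry C_{i}(a) = ⊥ and pushes i only after killing one.  Initially
-- Φ ≤ (n + n d) · R ≤ 10 e² d^(k+1).  A non-terminal reachable state can always step, since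
-- Project only needs a maximal element of a finite set of table entries, nonempty because every
-- domain is.
module Submission where

open import Defs
open import Level using (Level)
open import Function using (_∘_)
open import Data.Bool using (true; false; if_then_else_)
open import Data.Unit using (tt) renaming (⊤ to Unit)
open import Data.Empty using (⊥-elim)
open import Data.Product using (∃; ∃-syntax; _×_; Σ; _,_; proj₁; proj₂)
open import Data.Sum using (_⊎_; inj₁; inj₂)
open import Data.Nat using (ℕ; zero; suc; _≤_; _<_; _+_; _*_; _^_; _⊔_; z≤n; s≤s; NonZero; >-nonZero)
import Data.Nat.Properties as ℕ
open import Data.Nat.Tactic.RingSolver using (solve-∀)
open import Algebra.Properties.Monoid.Sum ℕ.+-0-monoid using (sum-syntax)
open import Algebra.Properties.CommutativeSemigroup ℕ.+-commutativeSemigroup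
  using () renaming (x∙yz≈y∙xz to +-left-comm)
open import Algebra.Properties.CommutativeSemigroup ℕ.*-commutativeSemigroup
  using () renaming (x∙yz≈y∙xz to *-left-comm)
open import Algebra.Lattice.Structures using (IsLattice)
open import Data.Fin using (Fin; zero; suc; fromℕ<)
import Data.Fin.Properties as Fin
open import Data.Fin.Subset using (Subset; ∣_∣; _-_) renaming (_∈_ to _∈ₛ_)
open import Data.Fin.Subset.Properties using (p─⊥≡p)
open import Data.Vec using () renaming (_∷_ to _∷ᵥ_; [] to []ᵥ; here to hereᵥ; there to thereᵥ)
open import Data.List using (List; []; _∷_; _++_; filter; map; length; foldr; allFin; cartesianProduct)
open import Data.List.Properties using (length-++-sucʳ; length-tabulate; length-filter)
open import Data.List.Membership.Propositional using (_∈_)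
open import Data.List.Membership.Propositional.Properties
  using (∈-map⁺; ∈-map⁻; ∈-filter⁺; ∈-filter⁻; ∈-allFin; ∈-cartesianProduct⁺)
open import Data.List.Relation.Unary.Any using (here; there)
open import Data.List.Relation.Unary.All using (All; []; _∷_) renaming (map to All-map; head to All-head)
open import Data.List.Relation.Unary.All.Properties using (all-filter; ++⁺; ++⁻ˡ; ++⁻ʳ)
open import Relation.Nullary using (¬_; Dec; yes; no; does; ¬?)
open import Relation.Nullary.Decidable using (_×-dec_; dec-true; dec-false)
open import Relation.Binary.Bundles using (DecPoset)
open import Relation.Binary.PropositionalEquality
  using (_≡_; refl; sym; trans; cong; cong₂; subst; subst₂; isEquivalence; module ≡-Reasoning)

∑-mono-≤ : ∀ {n} {f g : Fin n → ℕ} → (∀ i → f i ≤ g i) → ∑[ i < n ] f i ≤ ∑[ i < n ] g i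
∑-mono-≤ {zero}  f≤g = z≤n
∑-mono-≤ {suc n} f≤g = ℕ.+-mono-≤ (f≤g zero) (∑-mono-≤ (f≤g ∘ suc))

∑-mono-< : ∀ {n} {f g : Fin n → ℕ} → (∀ i → f i ≤ g i) →
           ∀ j → f j < g j → ∑[ i < n ] f i < ∑[ i < n ] g i
∑-mono-< f≤g zero    fj<gj = ℕ.+-mono-<-≤ fj<gj (∑-mono-≤ (f≤g ∘ suc))
∑-mono-< f≤g (suc j) fj<gj = ℕ.+-mono-≤-< (f≤g zero) (∑-mono-< (f≤g ∘ suc) j fj<gj)

∑-≤-* : ∀ {n b} {f : Fin n → ℕ} → (∀ i → f i ≤ b) → ∑[ i < n ] f i ≤ n * b
∑-≤-* {zero}  f≤b = z≤n
∑-≤-* {suc n} f≤b = ℕ.+-mono-≤ (f≤b zero) (∑-≤-* (f≤b ∘ suc))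

*-≤-∑ : ∀ {n b} {f : Fin n → ℕ} → (∀ i → b ≤ f i) → n * b ≤ ∑[ i < n ] f i
*-≤-∑ {zero}  b≤f = z≤n
*-≤-∑ {suc n} b≤f = ℕ.+-mono-≤ (b≤f zero) (*-≤-∑ (b≤f ∘ suc))

∈⇒≤-max : ∀ {x xs} → x ∈ xs → x ≤ foldr _⊔_ 0 xs
∈⇒≤-max (here refl)              = ℕ.m≤m⊔n _ _
∈⇒≤-max {xs = y ∷ _} (there x∈) = ℕ.≤-trans (∈⇒≤-max x∈) (ℕ.m≤n⊔m y _)

All-++∷⁻ : ∀ {a p} {A : Set a} {P : A → Set p} xs {y} ys →
           All P (xs ++ y ∷ ys) → P y × All P (xs ++ ys)
All-++∷⁻ xs ys all with ++⁻ʳ xs all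
... | py ∷ pys = py , ++⁺ (++⁻ˡ xs all) pys

charge : ∀ {W W′ w b c} R → W′ ≤ W → w + b ≤ c → w + (W′ * R + b) ≤ W * R + c
charge {W} {W′} {w} {b} {c} R W′≤W w+b≤c = begin
  w + (W′ * R + b)  ≡⟨ +-left-comm w (W′ * R) b ⟩
  W′ * R + (w + b)  ≤⟨ ℕ.+-mono-≤ (ℕ.*-monoˡ-≤ R W′≤W) w+b≤c ⟩
  W * R + c         ∎
  where open ℕ.≤-Reasoning

charge-suc : ∀ {W w b} R → w + b ≤ R → w + (W * R + b) ≤ suc W * R + 0
charge-suc {W} {w} {b} R w+b≤R = begin
  w + (W * R + b)  ≡⟨ +-left-comm w (W * R) b ⟩
  W * R + (w + b)  ≤⟨ ℕ.+-monoʳ-≤ (W * R) w+b≤R ⟩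
  W * R + R        ≡⟨ ℕ.+-comm (W * R) R ⟩
  suc W * R        ≡⟨ ℕ.+-identityʳ (suc W * R) ⟨
  suc W * R + 0    ∎
  where open ℕ.≤-Reasoning

polynomial-bound : ∀ e m d k W → 1 ≤ k → m ≤ e → W ≤ 2 * (e * d) →
                   W * (suc e + (1 + m * (d + d ^ k))) ≤ 10 * e ^ 2 * d ^ (k + 1)
polynomial-bound zero m d k W _ _ W≤0
  rewrite ℕ.n≤0⇒n≡0 W≤0 = z≤n
polynomial-bound e@(suc _) m zero k W _ _ W≤2e0
  rewrite ℕ.n≤0⇒n≡0 (subst (λ z → W ≤ 2 * z) (ℕ.*-zeroʳ e) W≤2e0) = z≤n
polynomial-bound e@(suc _) m d@(suc _) k W 1≤k m≤e W≤2ed = begin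
  W * (suc e + (1 + m * (d + X)))  ≤⟨ ℕ.*-mono-≤ W≤2ed R≤5eX ⟩
  2 * (e * d) * (5 * e * X)        ≡⟨ regroup e d X ⟩
  10 * e ^ 2 * (X * d ^ 1)         ≡⟨ cong (10 * e ^ 2 *_) (ℕ.^-distribˡ-+-* d k 1) ⟨
  10 * e ^ 2 * d ^ (k + 1)         ∎
  where
  open ℕ.≤-Reasoning
  X : ℕ
  X = d ^ k
  1≤e : 1 ≤ e
  1≤e = s≤s z≤n
  1≤X : 1 ≤ X
  1≤X = ℕ.^-monoʳ-≤ d (z≤n {k})
  d≤X : d ≤ X
  d≤X = subst (_≤ X) (ℕ.*-identityʳ d) (ℕ.^-monoʳ-≤ d 1≤k)
  2+e≤3eX : suc e + 1 ≤ 3 * e * X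
  2+e≤3eX = begin
    suc e + 1      ≤⟨ ℕ.+-mono-≤ (ℕ.+-monoˡ-≤ e 1≤e) 1≤e ⟩
    e + e + e      ≡⟨ triple e ⟩
    3 * e * 1      ≤⟨ ℕ.*-monoʳ-≤ (3 * e) 1≤X ⟩
    3 * e * X      ∎
    where
    triple : ∀ a → a + a + a ≡ 3 * a * 1
    triple = solve-∀
  R≤5eX : suc e + (1 + m * (d + X)) ≤ 5 * e * X
  R≤5eX = begin
    suc e + (1 + m * (d + X))  ≡⟨ ℕ.+-assoc (suc e) 1 _ ⟨
    suc e + 1 + m * (d + X)    ≤⟨ ℕ.+-mono-≤ 2+e≤3eX (ℕ.*-mono-≤ m≤e (ℕ.+-monoˡ-≤ X d≤X)) ⟩
    3 * e * X + e * (X + X)    ≡⟨ collect e X ⟩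
    5 * e * X                  ∎
    where
    collect : ∀ a x → 3 * a * x + a * (x + x) ≡ 5 * a * x
    collect = solve-∀
  regroup : ∀ a b x → 2 * (a * b) * (5 * a * x) ≡ 10 * (a * (a * 1)) * (x * (b * 1))
  regroup = solve-∀

tuples : ∀ {n} (D : Fin n → ℕ) (Y : Subset n) → List (Tuple D Y)
tuples {zero}  D []ᵥ          = tt ∷ []
tuples {suc n} D (true ∷ᵥ Y)  = cartesianProduct (allFin (D zero)) (tuples (D ∘ suc) Y)
tuples {suc n} D (false ∷ᵥ Y) = tuples (D ∘ suc) Y

∈-tuples : ∀ {n} (D : Fin n → ℕ) (Y : Subset n) (t : Tuple D Y) → t ∈ tuples D Y
∈-tuples {zero}  D []ᵥ          tt      = here refl
∈-tuples {suc n} D (true ∷ᵥ Y)  (a , t) = ∈-cartesianProduct⁺ (∈-allFin a) (∈-tuples (D ∘ suc) Y t)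
∈-tuples {suc n} D (false ∷ᵥ Y) t       = ∈-tuples (D ∘ suc) Y t

someTuple : ∀ {n} {D : Fin n → ℕ} → (∀ v → 1 ≤ D v) → (Y : Subset n) → Tuple D Y
someTuple {zero}  D≥1 []ᵥ          = tt
someTuple {suc n} D≥1 (true ∷ᵥ Y)  = fromℕ< (D≥1 zero) , someTuple (D≥1 ∘ suc) Y
someTuple {suc n} D≥1 (false ∷ᵥ Y) = someTuple (D≥1 ∘ suc) Y

tupleThrough : ∀ {n} {D : Fin n → ℕ} → (∀ v → 1 ≤ D v) →
               (Y : Subset n) (i : Fin n) (p : i ∈ₛ Y) (a : Fin (D i)) →
               Σ (Tuple D Y) λ t → get D Y t i p ≡ a
tupleThrough D≥1 (true ∷ᵥ Y)  zero    hereᵥ      a = (a , someTuple (D≥1 ∘ suc) Y) , refl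
tupleThrough D≥1 (true ∷ᵥ Y)  (suc i) (thereᵥ p) a =
  let t , t[i]≡a = tupleThrough (D≥1 ∘ suc) Y i p a in (fromℕ< (D≥1 zero) , t) , t[i]≡a
tupleThrough D≥1 (false ∷ᵥ Y) (suc i) (thereᵥ p) a = tupleThrough (D≥1 ∘ suc) Y i p a

card-remove : ∀ {n} (D : Fin n → ℕ) (Y : Subset n) {i} → i ∈ₛ Y → D i * card D (Y - i) ≡ card D Y
card-remove D (true ∷ᵥ Y) hereᵥ = cong (λ Z → D zero * card (D ∘ suc) Z) (p─⊥≡p Y)
card-remove D (true ∷ᵥ Y) {suc i} (thereᵥ p) = begin
  D (suc i) * (D zero * card (D ∘ suc) (Y - i))  ≡⟨ *-left-comm (D (suc i)) (D zero) _ ⟩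
  D zero * (D (suc i) * card (D ∘ suc) (Y - i))  ≡⟨ cong (D zero *_) (card-remove (D ∘ suc) Y p) ⟩
  D zero * card (D ∘ suc) Y                      ∎
  where open ≡-Reasoning
card-remove D (false ∷ᵥ Y) (thereᵥ p) = card-remove (D ∘ suc) Y p

card-≤-^ : ∀ {n b} (D : Fin n → ℕ) (Y : Subset n) → (∀ v → D v ≤ b) → card D Y ≤ b ^ ∣ Y ∣
card-≤-^ D []ᵥ          D≤b = ℕ.≤-refl
card-≤-^ D (true ∷ᵥ Y)  D≤b = ℕ.*-mono-≤ (D≤b zero) (card-≤-^ (D ∘ suc) Y (D≤b ∘ suc))
card-≤-^ D (false ∷ᵥ Y) D≤b = card-≤-^ (D ∘ suc) Y (D≤b ∘ suc)

module Maximal {c ℓ₁ ℓ₂} (P : DecPoset c ℓ₁ ℓ₂) where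
  open DecPoset P using (Carrier; _≈_; antisym; module Eq)
    renaming (_≤_ to _≼_; _≤?_ to _≼?_; refl to ≼-refl; trans to ≼-trans)

  maximal : Carrier → List Carrier → Carrier
  maximal x []       = x
  maximal x (y ∷ ys) with x ≼? y
  ... | yes _ = maximal y ys
  ... | no  _ = maximal x ys

  ≼-maximal : ∀ x ys → x ≼ maximal x ys
  ≼-maximal x []       = ≼-refl
  ≼-maximal x (y ∷ ys) with x ≼? y
  ... | yes x≼y = ≼-trans x≼y (≼-maximal y ys)
  ... | no  _   = ≼-maximal x ys

  maximal-∈ : ∀ x ys → maximal x ys ∈ x ∷ ys
  maximal-∈ x []       = here refl
  maximal-∈ x (y ∷ ys) with x ≼? y
  ... | yes _ = there (maximal-∈ y ys)
  ... | no  _ with maximal-∈ x ys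
  ...   | here  eq = here eq
  ...   | there m∈ = there (there m∈)

  maximal-maximal : ∀ x ys {z} → z ∈ x ∷ ys → maximal x ys ≼ z → z ≈ maximal x ys
  maximal-maximal x []       (here refl) _ = Eq.refl
  maximal-maximal x (y ∷ ys) z∈ m≼z with x ≼? y | z∈
  ... | yes x≼y | here refl = antisym (≼-trans x≼y (≼-maximal y ys)) m≼z
  ... | yes _   | there z∈′ = maximal-maximal y ys z∈′ m≼z
  ... | no  _   | here refl = maximal-maximal x ys (here refl) m≼z
  ... | no  x⋠y | there (here refl) = ⊥-elim (x⋠y (≼-trans (≼-maximal x ys) m≼z))
  ... | no  _   | there (there z∈′) = maximal-maximal x ys (there z∈′) m≼z

module DRLOrder {ℓ} (A : DRL ℓ) where
  open DRL A
  open IsLattice isLattice using (absorptive; ∧-assoc; ∧-comm)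

  ≤ₐ-refl : ∀ x → x ≤ₐ x
  ≤ₐ-refl x = trans (cong (x ∧_) (sym (proj₁ absorptive x x))) (proj₂ absorptive x (x ∧ x))

  ≤ₐ-trans : ∀ {x y z} → x ≤ₐ y → y ≤ₐ z → x ≤ₐ z
  ≤ₐ-trans {x} {y} {z} x≤y y≤z = begin
    x ∧ z        ≡⟨ cong (_∧ z) x≤y ⟨
    (x ∧ y) ∧ z  ≡⟨ ∧-assoc x y z ⟩
    x ∧ (y ∧ z)  ≡⟨ cong (x ∧_) y≤z ⟩
    x ∧ y        ≡⟨ x≤y ⟩
    x            ∎
    where open ≡-Reasoning

  ≤ₐ-antisym : ∀ {x y} → x ≤ₐ y → y ≤ₐ x → x ≡ y
  ≤ₐ-antisym {x} {y} x≤y y≤x = trans (sym x≤y) (trans (∧-comm x y) y≤x)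

  ≤ₐ-decPoset : DecPoset ℓ ℓ ℓ
  ≤ₐ-decPoset = record
    { isDecPartialOrder = record
      { isPartialOrder = record
        { isPreorder = record
          { isEquivalence = isEquivalence
          ; reflexive     = λ { refl → ≤ₐ-refl _ }
          ; trans         = ≤ₐ-trans
          }
        ; antisym = ≤ₐ-antisym
        }
      ; _≟_  = _≟_
      ; _≤?_ = λ x y → (x ∧ y) ≟ x
      }
    }

  active? : ∀ v → Dec (⊥ₐ <ₐ v)
  active? v = ((⊥ₐ ∧ v) ≟ ⊥ₐ) ×-dec ¬? (⊥ₐ ≟ v)

  ifActive_then_else_ : ∀ {b} {B : Set b} → Carrier → B → B → B
  ifActive v then x else y = if does (active? v) then x else y

  ifActive-active : ∀ {b} {B : Set b} {v} {x y : B} → ⊥ₐ <ₐ v → (ifActive v then x else y) ≡ x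
  ifActive-active {v = v} ⊥<v rewrite dec-true (active? v) ⊥<v = refl

  ifActive-inactive : ∀ {b} {B : Set b} {v} {x y : B} → ¬ ⊥ₐ <ₐ v → (ifActive v then x else y) ≡ y
  ifActive-inactive {v = v} ⊥≮v rewrite dec-false (active? v) ⊥≮v = refl

  alive : Carrier → ℕ
  alive v = ifActive v then 1 else 0

  alive-≤1 : ∀ v → alive v ≤ 1
  alive-≤1 v with does (active? v)
  ... | true  = ℕ.≤-refl
  ... | false = z≤n

  alive-⊥ : alive ⊥ₐ ≡ 0
  alive-⊥ = ifActive-inactive λ (_ , ⊥≢⊥) → ⊥≢⊥ refl

module Analysis {ℓ} (A : DRL ℓ) {n : ℕ} (P : SoftCSP A n) (k : ℕ) where
  open DRL A
  open SoftCSP P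
  open Algorithm A P k
  open DRLOrder A

  D≤d : ∀ i → D i ≤ d
  D≤d i = ∈⇒≤-max (∈-map⁺ D (∈-allFin i))

  Relevant : Fin n → Fin m → Set
  Relevant i j = i ∈ₛ scope j × ∣ scope j ∣ ≤ k

  relevant-Relevant : ∀ i → All (Relevant i) (relevant i)
  relevant-Relevant i = All-map (λ (i∈Y , _ , ∣Y∣≤k) → i∈Y , ∣Y∣≤k) (all-filter _ (allFin m))

  length-relevant : ∀ i → length (relevant i) ≤ m
  length-relevant i =
    subst (length (relevant i) ≤_) (length-tabulate {n = m} (λ j → j)) (length-filter _ (allFin m))

  maxProjCost : ℕ
  maxProjCost = d + d ^ k

  projCost-≤ : ∀ {i j} → Relevant i j → projCost i j ≤ maxProjCost
  projCost-≤ {i} {j} (i∈Y , ∣Y∣≤k) = begin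
    D i * (1 + card D (scope j - i))      ≡⟨ ℕ.*-distribˡ-+ (D i) 1 _ ⟩
    D i * 1 + D i * card D (scope j - i)  ≡⟨ cong₂ _+_ (ℕ.*-identityʳ (D i)) (card-remove D (scope j) i∈Y) ⟩
    D i + card D (scope j)                ≤⟨ ℕ.+-mono-≤ (D≤d i) (card-≤-^ D (scope j) D≤d) ⟩
    d + d ^ ∣ scope j ∣                   ≤⟨ ℕ.+-monoʳ-≤ d (ℕ.^-monoʳ-≤ d ∣Y∣≤k) ⟩
    d + d ^ k                             ∎
    where
    open ℕ.≤-Reasoning
    instance
      d≢0 : NonZero d
      d≢0 = >-nonZero (ℕ.≤-trans (D-nonempty i) (D≤d i))

  WellFormed : Phase → Set
  WellFormed (processing i js) = All (Relevant i) js
  WellFormed idle              = Unit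
  WellFormed haltedBot         = Unit

  Unary : Set ℓ
  Unary = (i : Fin n) → Fin (D i) → Carrier

  aliveCount : Unary → ℕ
  aliveCount u = ∑[ i < n ] ∑[ a < D i ] alive (u i a)

  aliveCount-≤ : ∀ u → aliveCount u ≤ n * d
  aliveCount-≤ u = ∑-≤-* λ i →
    ℕ.≤-trans (∑-≤-* (alive-≤1 ∘ u i)) (subst (_≤ d) (sym (ℕ.*-identityʳ (D i))) (D≤d i))

  module _ {i : Fin n} {u′ : Fin (D i) → Carrier} (u : Unary)
           (u′≤u : ∀ a → alive (u′ a) ≤ alive (u i a)) where

    private
      rowwise : ∀ v → ∑[ a < D v ] alive (updUnary i u′ u v a) ≤ ∑[ a < D v ] alive (u v a)
      rowwise v with v Fin.≟ i
      ... | yes refl = ∑-mono-≤ u′≤u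
      ... | no  _    = ℕ.≤-refl

      row-i : ∀ b → alive (u′ b) < alive (u i b) →
              ∑[ a < D i ] alive (updUnary i u′ u i a) < ∑[ a < D i ] alive (u i a)
      row-i b lt with i Fin.≟ i
      ... | yes refl = ∑-mono-< u′≤u b lt
      ... | no  i≢i  = ⊥-elim (i≢i refl)

    aliveCount-update-≤ : aliveCount (updUnary i u′ u) ≤ aliveCount u
    aliveCount-update-≤ = ∑-mono-≤ rowwise

    aliveCount-update-< : ∀ b → alive (u′ b) < alive (u i b) →
                          aliveCount (updUnary i u′ u) < aliveCount u
    aliveCount-update-< b lt = ∑-mono-< rowwise i (row-i b lt)

  alive-projected : ∀ {s i j p u′ t′} → ProjectOutcome s i j p u′ t′ →
                    ∀ a → alive (u′ a) ≤ alive (unary s i a)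
  alive-projected {s} {i} {u′ = u′} O a with active? (unary s i a)
  ... | yes ⊥<v = subst (alive (u′ a) ≤_) (sym (ifActive-active ⊥<v)) (alive-≤1 (u′ a))
  ... | no  ⊥≮v = ℕ.≤-reflexive (cong alive (ProjectOutcome.unary-inactive O a ⊥≮v))

  alive-flagged : ∀ {s i u′} → Flag s i u′ → ∃ λ a → alive (u′ a) < alive (unary s i a)
  alive-flagged (a , ⊥<v , u′a≡⊥) =
    a , subst₂ _<_ (sym (trans (cong alive u′a≡⊥) alive-⊥)) (sym (ifActive-active ⊥<v)) (s≤s z≤n)

  roundCost : ℕ
  roundCost = popCost + (1 + m * maxProjCost)

  weight : State → ℕ
  weight s = length (queue s) + aliveCount (unary s)

  pending : Phase → ℕ
  pending (processing i js) = 1 + length js * maxProjCost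
  pending idle              = 0
  pending haltedBot         = 0

  Φ : State → ℕ
  Φ s = weight s * roundCost + pending (phase s)

  weight-projected : ∀ {s i j p u′ t′} → ProjectOutcome s i j p u′ t′ →
                     length (queue s) + aliveCount (updUnary i u′ (unary s)) ≤ weight s
  weight-projected {s} O =
    ℕ.+-monoʳ-≤ (length (queue s)) (aliveCount-update-≤ (unary s) (alive-projected O))

  weight-pushed : ∀ {s i j p u′ t′} → ProjectOutcome s i j p u′ t′ → Flag s i u′ →
                  suc (length (queue s)) + aliveCount (updUnary i u′ (unary s)) ≤ weight s
  weight-pushed {s} O flag =
    let a , lt = alive-flagged {s} flag in
    ℕ.+-monoʳ-< (length (queue s)) (aliveCount-update-< (unary s) (alive-projected O) a lt)

  pending-removal : ∀ {w} i rs j rs′ → w ≤ maxProjCost →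
                    w + pending (processing i (rs ++ rs′)) ≤ pending (processing i (rs ++ j ∷ rs′))
  pending-removal {w} i rs j rs′ w≤max = begin
    w + (1 + L * maxProjCost)  ≡⟨ ℕ.+-suc w (L * maxProjCost) ⟩
    1 + (w + L * maxProjCost)  ≤⟨ s≤s (ℕ.+-monoˡ-≤ (L * maxProjCost) w≤max) ⟩
    1 + suc L * maxProjCost    ≡⟨ cong (λ L′ → 1 + L′ * maxProjCost) (length-++-sucʳ rs j rs′) ⟨
    pending (processing i (rs ++ j ∷ rs′)) ∎
    where
    open ℕ.≤-Reasoning
    L : ℕ
    L = length (rs ++ rs′)

  Φ-drop : ∀ {s s′ w} → weight s′ ≤ weight s → w + pending (phase s′) ≤ pending (phase s) →
           w + Φ s′ ≤ Φ s
  Φ-drop {s} {s′} {w} = charge {weight s} {weight s′} {w} {pending (phase s′)} roundCost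

  projection-drop : ∀ {s s′ i rs j rs′} →
                    phase s ≡ processing i (rs ++ j ∷ rs′) → WellFormed (phase s) →
                    weight s′ ≤ weight s → pending (phase s′) ≤ pending (processing i (rs ++ rs′)) →
                    projCost i j + Φ s′ ≤ Φ s × WellFormed (processing i (rs ++ rs′))
  projection-drop {s} {s′} {i} {rs} {j} {rs′} ph wf w′≤w p′≤p =
    let j-relevant , rest-relevant = All-++∷⁻ rs rs′ (subst WellFormed ph wf) in
    Φ-drop {s} {s′} w′≤w (subst (projCost i j + pending (phase s′) ≤_) (cong pending (sym ph))
      (ℕ.≤-trans (ℕ.+-monoʳ-≤ (projCost i j) p′≤p)
                 (pending-removal i rs j rs′ (projCost-≤ j-relevant)))) ,
    rest-relevant

  step-decreases-Φ : ∀ {s w s′} → Step s w s′ → WellFormed (phase s) →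
                     w + Φ s′ ≤ Φ s × WellFormed (phase s′)
  step-decreases-Φ {s} (pop xs i ys ph q) _ =
    subst (popCost + Φ s′ ≤_) (sym Φs≡) (charge-suc {weight s′} {popCost} roundCost pop-cost) ,
    relevant-Relevant i
    where
    s′ : State
    s′ = record s { queue = xs ++ ys ; phase = processing i (relevant i) }
    Φs≡ : Φ s ≡ suc (weight s′) * roundCost + 0
    Φs≡ = cong₂ (λ L ph → (L + aliveCount (unary s)) * roundCost + pending ph)
                (trans (cong length q) (length-++-sucʳ xs i ys)) ph
    pop-cost : popCost + pending (phase s′) ≤ roundCost
    pop-cost = ℕ.+-monoʳ-≤ popCost (ℕ.+-monoʳ-≤ 1 (ℕ.*-monoˡ-≤ maxProjCost (length-relevant i)))
  step-decreases-Φ {s} {s′ = s′} (finish i ph) _ =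
    Φ-drop {s} {s′} ℕ.≤-refl (ℕ.≤-reflexive (cong pending (sym ph))) , tt
  step-decreases-Φ {s} {s′ = s′} (project-halt i rs j rs′ p u′ t′ ph O _) wf =
    proj₁ (projection-drop {s} {s′} ph wf (weight-projected O) z≤n) , tt
  step-decreases-Φ {s} {s′ = s′} (project-continue i rs j rs′ p u′ t′ ph O _ _) wf =
    projection-drop {s} {s′} ph wf (weight-projected O) ℕ.≤-refl
  step-decreases-Φ {s} {s′ = s′} (project-push i rs j rs′ p u′ t′ ph O _ flag) wf =
    projection-drop {s} {s′} ph wf (weight-pushed O flag) ℕ.≤-refl

  module Projection (s : State) (i : Fin n) (j : Fin m) (i∈Y : i ∈ₛ scope j) where
    open Maximal ≤ₐ-decPoset

    at-i : Tuple D (scope j) → Fin (D i)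
    at-i t = get D (scope j) t i i∈Y

    at-i? : ∀ a t → Dec (at-i t ≡ a)
    at-i? a t = at-i t Fin.≟ a

    witness : Fin (D i) → Tuple D (scope j)
    witness a = proj₁ (tupleThrough D-nonempty (scope j) i i∈Y a)

    candidates : Fin (D i) → List (Tuple D (scope j))
    candidates a = witness a ∷ filter (at-i? a) (tuples D (scope j))

    candidates-at-i : ∀ {a t} → t ∈ candidates a → at-i t ≡ a
    candidates-at-i {a} (here refl) = proj₂ (tupleThrough D-nonempty (scope j) i i∈Y a)
    candidates-at-i {a} (there t∈)  = proj₂ (∈-filter⁻ (at-i? a) {xs = tuples D (scope j)} t∈)

    ∈-candidates : ∀ {a} t → at-i t ≡ a → t ∈ candidates a
    ∈-candidates {a} t t[i]≡a = there (∈-filter⁺ (at-i? a) (∈-tuples D (scope j) t) t[i]≡a)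

    x : Fin (D i) → Carrier
    x a = maximal (table s j (witness a)) (map (table s j) (filter (at-i? a) (tuples D (scope j))))

    x-max : ∀ a → IsMaximal (λ v → Σ (Tuple D (scope j)) λ t → at-i t ≡ a × table s j t ≡ v) (x a)
    x-max a = attained , maximality
      where
      attained : Σ (Tuple D (scope j)) λ t → at-i t ≡ a × table s j t ≡ x a
      attained with ∈-map⁻ (table s j) (maximal-∈ _ _)
      ... | t , t∈ , x≡t = t , candidates-at-i t∈ , sym x≡t
      maximality : ∀ y → (Σ (Tuple D (scope j)) λ t → at-i t ≡ a × table s j t ≡ y) →
                   x a ≤ₐ y → y ≡ x a
      maximality y (t , t[i]≡a , refl) = maximal-maximal _ _ (∈-map⁺ (table s j) (∈-candidates t t[i]≡a))

    u′ : Fin (D i) → Carrier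
    u′ a = ifActive unary s i a then unary s i a ⊙ x a else unary s i a

    t′ : Tuple D (scope j) → Carrier
    t′ t = ifActive unary s i (at-i t) then x (at-i t) ⇒ table s j t else table s j t

    outcome : ProjectOutcome s i j i∈Y u′ t′
    outcome = record
      { x              = x
      ; x-max          = λ a _ → x-max a
      ; unary-active   = λ _ → ifActive-active
      ; unary-inactive = λ _ → ifActive-inactive
      ; table-active   = λ _ → ifActive-active
      ; table-inactive = λ _ → ifActive-inactive
      }

    project : ∀ {rs′} → phase s ≡ processing i (j ∷ rs′) → ∃ λ s′ → ∃ λ w → Step s w s′
    project {rs′} ph with Fin.all? (λ a → u′ a ≟ ⊥ₐ)
    ... | yes all⊥ = _ , _ , project-halt i [] j rs′ i∈Y u′ t′ ph outcome all⊥
    ... | no  ¬all⊥ with Fin.any? (λ a → active? (unary s i a) ×-dec (u′ a ≟ ⊥ₐ))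
    ...   | yes flag = _ , _ , project-push i [] j rs′ i∈Y u′ t′ ph outcome ¬all⊥ flag
    ...   | no  ¬flag = _ , _ , project-continue i [] j rs′ i∈Y u′ t′ ph outcome ¬all⊥ ¬flag

  progress : ∀ s → WellFormed (phase s) → Terminal s ⊎ ∃ λ s′ → ∃ λ w → Step s w s′
  progress s wf with phase s in ph | queue s in q
  ... | idle                  | []     = inj₁ (inj₂ (refl , refl))
  ... | idle                  | i ∷ is = inj₂ (_ , _ , pop [] i is ph q)
  ... | processing i []       | _      = inj₂ (_ , _ , finish i ph)
  ... | processing i (j ∷ js) | _      = inj₂ (Projection.project s i j (proj₁ (All-head wf)) ph)
  ... | haltedBot             | _      = inj₁ (inj₁ refl)

  reachable : ∀ {s c} → Reach s c → c + Φ s ≤ Φ initial × WellFormed (phase s)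
  reachable start = ℕ.≤-refl , tt
  reachable (step {s} {c} {s′} {w} r st) =
    let c+Φs≤Φ₀ , wf = reachable r
        w+Φs′≤Φs , wf′ = step-decreases-Φ st wf
    in ℕ.≤-trans (ℕ.≤-reflexive (ℕ.+-assoc c w (Φ s′)))
                 (ℕ.≤-trans (ℕ.+-monoʳ-≤ c w+Φs′≤Φs) c+Φs≤Φ₀) , wf′

  Φ-initial-≤ : 1 ≤ k → Φ initial ≤ 10 * e ^ 2 * d ^ (k + 1)
  Φ-initial-≤ 1≤k = begin
    weight initial * roundCost + 0  ≡⟨ ℕ.+-identityʳ _ ⟩
    weight initial * roundCost      ≤⟨ polynomial-bound e m d k _ 1≤k (ℕ.m≤n+m m n) weight₀≤ ⟩
    10 * e ^ 2 * d ^ (k + 1)        ∎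
    where
    open ℕ.≤-Reasoning
    nd≤ed : n * d ≤ e * d
    nd≤ed = ℕ.*-monoˡ-≤ d (ℕ.m≤m+n n m)
    n≤nd : n ≤ n * d
    n≤nd = begin
      n               ≡⟨ ℕ.*-identityʳ n ⟨
      n * 1           ≤⟨ *-≤-∑ D-nonempty ⟩
      ∑[ i < n ] D i  ≤⟨ ∑-≤-* D≤d ⟩
      n * d           ∎
    weight₀≤ : weight initial ≤ 2 * (e * d)
    weight₀≤ = begin
      length (allFin n) + aliveCount unary₀  ≡⟨ cong (_+ aliveCount unary₀) (length-tabulate {n = n} (λ i → i)) ⟩
      n + aliveCount unary₀                  ≤⟨ ℕ.+-mono-≤ n≤nd (aliveCount-≤ unary₀) ⟩
      n * d + n * d                          ≤⟨ ℕ.+-mono-≤ nd≤ed nd≤ed ⟩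
      e * d + e * d                          ≡⟨ cong (e * d +_) (ℕ.+-identityʳ (e * d)) ⟨
      2 * (e * d)                            ∎

lemma4p1 : ∀ {ℓ : Level} (k : ℕ) → 2 ≤ k →
    ∃[ c ] (∀ (A : DRL ℓ) (n : ℕ) (P : SoftCSP A n) (s : Algorithm.State A P k) (t : ℕ) →
      Algorithm.Reach A P k s t →
      t ≤ c * (SoftCSP.e P ^ 2) * (SoftCSP.d P ^ (k + 1))
      × (Algorithm.Terminal A P k s ⊎ ∃ (λ s' → ∃ (λ w → Algorithm.Step A P k s w s'))))
lemma4p1 k 2≤k = 10 , λ A n P s t reach →
  let open Analysis A P k
      t+Φs≤Φ₀ , wf = reachable reach
      1≤k = ℕ.≤-trans (s≤s z≤n) 2≤k
  in ℕ.≤-trans (ℕ.m≤m+n t (Φ s)) (ℕ.≤-trans t+Φs≤Φ₀ (Φ-initial-≤ 1≤k)) , progress s wf
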